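{- For any $n\in\mathbb{N}$ and any $\mathcal{L}$-formula $A$, $\mathbf{QK}\vdash\Box^{n+1}\bot\to(A\leftrightarrow A^{\top(n)})$.
   Context: Language $\mathcal{L}$: individual variables, $\top,\bot$, $\neg,\to$, $\forall$, $\Box$, countably many predicate symbols of each arity; formulas built from $\top,\bot,P(u_1,\ldots,u_n)$ by $\neg,\to,\forall u,\Box$. $\Box^k A$ is $A$ prefixed by $k$ boxes. The depth of an occurrence of a subformula $B$ in $A$ is the number of subformulas of $A$ of the form $\Box C$ that contain that occurrence of $B$, other than $B$ itself. $A^{\top(n)}$ denotes the formula obtained from $A$ by replacing every occurrence of a subformula of the form $\Box B$ of depth $n$ by $\top$. $\mathbf{QK}$: all instances of the axioms of classical first-order predicate logic and $\Box(A\to B)\to(\Box A\to\Box B)$, with rules modus ponens, generalization and necessitation $A/\Box A$. -}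

module Defs where

open import Data.Nat using (ℕ; zero; suc)
open import Data.Nat.Properties using (_≟_)
open import Data.Bool using (Bool; true; false; not; _∧_; _∨_)
open import Data.Vec using (Vec; map)
open import Data.Vec.Membership.Propositional using (_∈_)
open import Data.Empty using (⊥)
open import Data.Unit using () renaming (⊤ to Unit)
open import Data.Sum using (_⊎_)
open import Data.Product using (_×_)
open import Relation.Nullary using (¬_; yes; no)
open import Relation.Binary.PropositionalEquality using (_≡_)

Var : Set
Var = ℕ

-- Formulas of L.  'pred k i us' is the i-th predicate symbol of arity k
-- applied to the variables us (countably many predicate symbols of each arity).
infixr 6 _⇒_
data Formula : Set where
  ⊤'   : Formula
  ⊥'   : Formula
  pred : (k i : ℕ) → Vec Var k → Formula
  ¬'_  : Formula → Formula
  _⇒_  : Formula → Formula → Formula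
  ∀'   : Var → Formula → Formula
  □_   : Formula → Formula

_∧'_ : Formula → Formula → Formula
A ∧' B = ¬' (A ⇒ ¬' B)

_⇔_ : Formula → Formula → Formula
A ⇔ B = (A ⇒ B) ∧' (B ⇒ A)

□^ : ℕ → Formula → Formula
□^ zero    A = A
□^ (suc k) A = □ (□^ k A)

-- A^{⊤(n)}: replace every occurrence of a subformula □B of depth n by ⊤.
-- (the depth counter increases by one when passing under a box)
_^⊤_ : Formula → ℕ → Formula
⊤' ^⊤ n = ⊤'
⊥' ^⊤ n = ⊥'
pred k i us ^⊤ n = pred k i us
(¬' A) ^⊤ n = ¬' (A ^⊤ n)
(A ⇒ B) ^⊤ n = (A ^⊤ n) ⇒ (B ^⊤ n)
∀' u A ^⊤ n = ∀' u (A ^⊤ n)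
(□ A) ^⊤ zero = ⊤'
(□ A) ^⊤ suc n = □ (A ^⊤ n)

-- Classical propositional tautologies (instances): truth under every
-- Boolean valuation of the prime (atomic, ∀- and □-) subformulas.

eval : (Formula → Bool) → Formula → Bool
eval v ⊤' = true
eval v ⊥' = false
eval v (pred k i us) = v (pred k i us)
eval v (¬' A) = not (eval v A)
eval v (A ⇒ B) = not (eval v A) ∨ eval v B
eval v (∀' u A) = v (∀' u A)
eval v (□ A) = v (□ A)

Tautology : Formula → Set
Tautology A = (v : Formula → Bool) → eval v A ≡ true

data Free (x : Var) : Formula → Set where
  f-pred : ∀ {k i us} → x ∈ us → Free x (pred k i us)
  f-neg  : ∀ {A} → Free x A → Free x (¬' A)
  f-impl : ∀ {A B} → Free x A → Free x (A ⇒ B)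
  f-impr : ∀ {A B} → Free x B → Free x (A ⇒ B)
  f-all  : ∀ {u A} → ¬ (u ≡ x) → Free x A → Free x (∀' u A)
  f-box  : ∀ {A} → Free x A → Free x (□ A)

sv : Var → Var → Var → Var
sv y x z with z ≟ x
... | yes _ = y
... | no  _ = z

_[_/_] : Formula → Var → Var → Formula
⊤' [ y / x ] = ⊤'
⊥' [ y / x ] = ⊥'
pred k i us [ y / x ] = pred k i (map (sv y x) us)
(¬' A) [ y / x ] = ¬' (A [ y / x ])
(A ⇒ B) [ y / x ] = (A [ y / x ]) ⇒ (B [ y / x ])
∀' u A [ y / x ] with u ≟ x
... | yes _ = ∀' u A
... | no  _ = ∀' u (A [ y / x ])
(□ A) [ y / x ] = □ (A [ y / x ])

FreeFor : Var → Var → Formula → Set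
FreeFor y x ⊤' = Unit
FreeFor y x ⊥' = Unit
FreeFor y x (pred k i us) = Unit
FreeFor y x (¬' A) = FreeFor y x A
FreeFor y x (A ⇒ B) = FreeFor y x A × FreeFor y x B
FreeFor y x (∀' u A) = ¬ Free x (∀' u A) ⊎ (¬ (u ≡ y) × FreeFor y x A)
FreeFor y x (□ A) = FreeFor y x A

data QK⊢_ : Formula → Set where
  taut : ∀ {A} → Tautology A → QK⊢ A
  inst : ∀ {x y A} → FreeFor y x A → QK⊢ (∀' x A ⇒ (A [ y / x ]))
  vac  : ∀ {x A} → ¬ Free x A → QK⊢ (A ⇒ ∀' x A)
  dist : ∀ {x A B} → QK⊢ (∀' x (A ⇒ B) ⇒ (∀' x A ⇒ ∀' x B))
  K    : ∀ {A B} → QK⊢ (□ (A ⇒ B) ⇒ (□ A ⇒ □ B))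
  mp   : ∀ {A B} → QK⊢ (A ⇒ B) → QK⊢ A → QK⊢ B
  gen  : ∀ {x A} → QK⊢ A → QK⊢ ∀' x A
  nec  : ∀ {A} → QK⊢ A → QK⊢ (□ A)

module Submission where

-- Write H for the hypothesis □^{n+1}⊥.  We show that
-- QK ⊢ H → (A ↔ A^{⊤(n)}) by induction on A, so the argument is a list of
-- congruence rules for "equivalence under a hypothesis":
--   * propositional connectives preserve equivalence under any H;
--   * ∀u preserves it when u is not free in H, and □^{k}⊥ is closed;
--   * □ turns equivalence under H into equivalence under □H, which is how
--     the hypothesis □^{n+2}⊥ at a box of depth < n+1 is reduced to □^{n+1}⊥;
--   * under □⊥ every formula □B is equivalent to ⊤, which handles the boxes
--     of depth exactly n that A^{⊤(n)} replaces by ⊤.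
-- The propositional steps are instances of classical tautologies.

open import Defs
open import Data.Nat using (ℕ; zero; suc)
open import Data.Bool using (Bool; true; false; not; _∧_; _∨_; T)
open import Data.Bool.Properties using (T-∧; T-≡)
open import Data.Fin using (Fin; zero; suc)
open import Data.Vec using (Vec; []; _∷_; lookup; map)
open import Data.Vec.Properties using (lookup-map)
open import Data.Product using (proj₁; proj₂)
open import Data.Unit using (tt)
open import Function.Bundles using (Equivalence)
open import Relation.Nullary using (¬_)
open import Relation.Binary.PropositionalEquality using (_≡_; refl; sym; cong; cong₂)

-- The abbreviation _⇔ₚ_ mirrors Defs._⇔_, so that
-- ⟦ P ⇔ₚ Q ⟧ σ is definitionally ⟦ P ⟧ σ ⇔ ⟦ Q ⟧ σ.
infixr 6 _⇒ₚ_
infix  5 _⇔ₚ_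
infix  7 ¬ₚ_
data Schema (k : ℕ) : Set where
  var  : Fin k → Schema k
  ⊤ₚ   : Schema k
  ⊥ₚ   : Schema k
  ¬ₚ_  : Schema k → Schema k
  _⇒ₚ_ : Schema k → Schema k → Schema k

_⇔ₚ_ : ∀ {k} → Schema k → Schema k → Schema k
P ⇔ₚ Q = ¬ₚ ((P ⇒ₚ Q) ⇒ₚ ¬ₚ (Q ⇒ₚ P))

⟦_⟧ : ∀ {k} → Schema k → Vec Formula k → Formula
⟦ var i ⟧  σ = lookup σ i
⟦ ⊤ₚ ⟧     σ = ⊤'
⟦ ⊥ₚ ⟧     σ = ⊥'
⟦ ¬ₚ P ⟧   σ = ¬' ⟦ P ⟧ σ
⟦ P ⇒ₚ Q ⟧ σ = ⟦ P ⟧ σ ⇒ ⟦ Q ⟧ σ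

value : ∀ {k} → Schema k → Vec Bool k → Bool
value (var i)  bs = lookup bs i
value ⊤ₚ       bs = true
value ⊥ₚ       bs = false
value (¬ₚ P)   bs = not (value P bs)
value (P ⇒ₚ Q) bs = not (value P bs) ∨ value Q bs

eval-⟦⟧ : ∀ {k} (v : Formula → Bool) (P : Schema k) (σ : Vec Formula k) →
          eval v (⟦ P ⟧ σ) ≡ value P (map (eval v) σ)
eval-⟦⟧ v (var i)  σ = sym (lookup-map i (eval v) σ)
eval-⟦⟧ v ⊤ₚ       σ = refl
eval-⟦⟧ v ⊥ₚ       σ = refl
eval-⟦⟧ v (¬ₚ P)   σ = cong not (eval-⟦⟧ v P σ)
eval-⟦⟧ v (P ⇒ₚ Q) σ = cong₂ (λ a b → not a ∨ b) (eval-⟦⟧ v P σ) (eval-⟦⟧ v Q σ)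

holdsForAll : (k : ℕ) → (Vec Bool k → Bool) → Bool
holdsForAll zero    f = f []
holdsForAll (suc k) f = holdsForAll k (λ bs → f (true ∷ bs))
                      ∧ holdsForAll k (λ bs → f (false ∷ bs))

holdsForAll-sound : ∀ k (f : Vec Bool k → Bool) →
                    T (holdsForAll k f) → ∀ bs → T (f bs)
holdsForAll-sound zero    f ok [] = ok
holdsForAll-sound (suc k) f ok (true ∷ bs) =
  holdsForAll-sound k _ (proj₁ (Equivalence.to T-∧ ok)) bs
holdsForAll-sound (suc k) f ok (false ∷ bs) =
  holdsForAll-sound k _ (proj₂ (Equivalence.to T-∧ ok)) bs

Valid : ∀ {k} → Schema k → Set
Valid {k} P = T (holdsForAll k (value P))

-- Every instance of a valid schema is a tautology; validity of a concrete
-- schema is established by computation ('tt').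
instance-taut : ∀ {k} (P : Schema k) → Valid P → (σ : Vec Formula k) →
                Tautology (⟦ P ⟧ σ)
instance-taut P valid σ v rewrite eval-⟦⟧ v P σ =
  Equivalence.to T-≡ (holdsForAll-sound _ (value P) valid (map (eval v) σ))

p₀ : ∀ {k} → Schema (suc k)
p₀ = var zero

p₁ : ∀ {k} → Schema (suc (suc k))
p₁ = var (suc zero)

p₂ : ∀ {k} → Schema (suc (suc (suc k)))
p₂ = var (suc (suc zero))

p₃ : ∀ {k} → Schema (suc (suc (suc (suc k))))
p₃ = var (suc (suc (suc zero)))

p₄ : ∀ {k} → Schema (suc (suc (suc (suc (suc k)))))
p₄ = var (suc (suc (suc (suc zero))))

by-taut₁ : ∀ {X Y} → Tautology (X ⇒ Y) → QK⊢ X → QK⊢ Y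
by-taut₁ t p = mp (taut t) p

by-taut₂ : ∀ {X Y Z} → Tautology (X ⇒ (Y ⇒ Z)) → QK⊢ X → QK⊢ Y → QK⊢ Z
by-taut₂ t p q = mp (mp (taut t) p) q

syllogism : ∀ {X Y Z} → QK⊢ (X ⇒ Y) → QK⊢ (Y ⇒ Z) → QK⊢ (X ⇒ Z)
syllogism {X} {Y} {Z} = by-taut₂
  (instance-taut ((p₀ ⇒ₚ p₁) ⇒ₚ (p₁ ⇒ₚ p₂) ⇒ₚ (p₀ ⇒ₚ p₂)) tt (X ∷ Y ∷ Z ∷ []))

⇒-∀ : ∀ {H A B} u → ¬ Free u H →
      QK⊢ (H ⇒ (A ⇒ B)) → QK⊢ (H ⇒ (∀' u A ⇒ ∀' u B))
⇒-∀ u u∉H p = syllogism (vac u∉H) (syllogism (mp dist (gen p)) dist)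

⇒-□ : ∀ {H A B} → QK⊢ (H ⇒ (A ⇒ B)) → QK⊢ (□ H ⇒ (□ A ⇒ □ B))
⇒-□ p = syllogism (mp K (nec p)) K

EquivUnder : Formula → Formula → Formula → Set
EquivUnder H A B = QK⊢ (H ⇒ (A ⇔ B))

equiv-refl : ∀ {H A} → EquivUnder H A A
equiv-refl {H} {A} = taut (instance-taut (p₀ ⇒ₚ (p₁ ⇔ₚ p₁)) tt (H ∷ A ∷ []))

equiv-¬ : ∀ {H A B} → EquivUnder H A B → EquivUnder H (¬' A) (¬' B)
equiv-¬ {H} {A} {B} = by-taut₁ (instance-taut
  ((p₀ ⇒ₚ (p₁ ⇔ₚ p₂)) ⇒ₚ (p₀ ⇒ₚ (¬ₚ p₁ ⇔ₚ ¬ₚ p₂))) tt (H ∷ A ∷ B ∷ []))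

equiv-⇒ : ∀ {H A B C D} → EquivUnder H A B → EquivUnder H C D →
          EquivUnder H (A ⇒ C) (B ⇒ D)
equiv-⇒ {H} {A} {B} {C} {D} = by-taut₂ (instance-taut
  ((p₀ ⇒ₚ (p₁ ⇔ₚ p₂)) ⇒ₚ (p₀ ⇒ₚ (p₃ ⇔ₚ p₄)) ⇒ₚ (p₀ ⇒ₚ ((p₁ ⇒ₚ p₃) ⇔ₚ (p₂ ⇒ₚ p₄))))
  tt (H ∷ A ∷ B ∷ C ∷ D ∷ []))

-- An operation F that is monotone for implication under hypotheses
-- (from H to H') preserves equivalence, since ↔ is a pair of implications.
equiv-lift : ∀ {H H' A B} (F : Formula → Formula) →
             (∀ {X Y} → QK⊢ (H ⇒ (X ⇒ Y)) → QK⊢ (H' ⇒ (F X ⇒ F Y))) →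
             EquivUnder H A B → EquivUnder H' (F A) (F B)
equiv-lift {H} {H'} {A} {B} F mono A↔B = by-taut₂
  (instance-taut ((p₀ ⇒ₚ (p₁ ⇒ₚ p₂)) ⇒ₚ (p₀ ⇒ₚ (p₂ ⇒ₚ p₁)) ⇒ₚ (p₀ ⇒ₚ (p₁ ⇔ₚ p₂)))
                 tt (H' ∷ F A ∷ F B ∷ []))
  (mono (by-taut₁ (instance-taut (forward ⇒ₚ (p₀ ⇒ₚ (p₁ ⇒ₚ p₂))) tt (H ∷ A ∷ B ∷ [])) A↔B))
  (mono (by-taut₁ (instance-taut (forward ⇒ₚ (p₀ ⇒ₚ (p₂ ⇒ₚ p₁))) tt (H ∷ A ∷ B ∷ [])) A↔B))
  where
    forward : Schema 3
    forward = p₀ ⇒ₚ (p₁ ⇔ₚ p₂)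

equiv-∀ : ∀ {H A B} u → ¬ Free u H →
          EquivUnder H A B → EquivUnder H (∀' u A) (∀' u B)
equiv-∀ u u∉H = equiv-lift (∀' u) (⇒-∀ u u∉H)

equiv-□ : ∀ {H A B} → EquivUnder H A B → EquivUnder (□ H) (□ A) (□ B)
equiv-□ = equiv-lift □_ ⇒-□

-- Under □⊥ every boxed formula is equivalent to ⊤: from ⊢ ⊥ → A, K gives
-- ⊢ □⊥ → □A.
□⊥-trivialises : ∀ {A} → EquivUnder (□ ⊥') (□ A) ⊤'
□⊥-trivialises {A} = by-taut₁
  (instance-taut ((p₀ ⇒ₚ p₁) ⇒ₚ (p₀ ⇒ₚ (p₁ ⇔ₚ ⊤ₚ))) tt (□ ⊥' ∷ □ A ∷ []))
  (mp K (nec (taut (instance-taut (⊥ₚ ⇒ₚ p₀) tt (A ∷ [])))))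

-- □^k ⊥ is a closed formula, so generalization may be used under it.
□^⊥-closed : ∀ k x → ¬ Free x (□^ k ⊥')
□^⊥-closed zero    x ()
□^⊥-closed (suc k) x (f-box p) = □^⊥-closed k x p

-- For n = 0 an outermost box is replaced
-- by ⊤, justified by □⊥; for n+1 it is kept, and the claim for □A under
-- □^{n+2}⊥ follows by equiv-□ from the claim for A under □^{n+1}⊥.
lemma4p4 : (n : ℕ) (A : Formula) → QK⊢ (□^ (suc n) ⊥' ⇒ (A ⇔ (A ^⊤ n)))
lemma4p4 n       ⊤'            = equiv-refl
lemma4p4 n       ⊥'            = equiv-refl
lemma4p4 n       (pred k i us) = equiv-refl
lemma4p4 n       (¬' A)        = equiv-¬ (lemma4p4 n A)
lemma4p4 n       (A ⇒ B)       = equiv-⇒ (lemma4p4 n A) (lemma4p4 n B)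
lemma4p4 n       (∀' u A)      = equiv-∀ u (□^⊥-closed (suc n) u) (lemma4p4 n A)
lemma4p4 zero    (□ A)         = □⊥-trivialises
lemma4p4 (suc n) (□ A)         = equiv-□ (lemma4p4 n A)
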